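{- Let $p$ be a prime. If $1\le n\le p$, then $\lambda_p(n)=n$.
   Context: For $\vec v=(v_1,\dots,v_n)\in\mathbb{F}_p^n$, $\|\vec v\|$ denotes the number of nonzero coordinates of $\vec v$. For a matrix $M$ over $\mathbb{F}_p$, its capacity is $c(M)=\max_{\vec v\in \mathrm{row}(M)}\|\vec v\|$, where $\mathrm{row}(M)$ is the $\mathbb{F}_p$-span of its rows. For $n\ge1$, $\mathcal{M}_n^*$ is the set of $m\times n$ matrices over $\mathbb{F}_p$ with $1\le m\le p^n$ and no zero column, and $\lambda_p(n)=\min_{M\in\mathcal{M}_n^*} c(M)$. -}

module Defs where

open import Data.Nat using (ℕ; zero; suc; _+_; _*_; _^_; _≤_; _%_)
open import Data.Nat.Primality using (Prime; prime⇒nonZero)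
open import Data.Fin using (Fin; toℕ) renaming (zero to fzero; suc to fsuc)
open import Data.Product using (Σ; ∃; _×_)
open import Relation.Binary.PropositionalEquality using (_≡_; _≢_)
open import Relation.Nullary using (yes; no)
open import Data.Nat using (_≟_)

-- Elements of 𝔽_p are represented by Fin p = {0,…,p-1} (residues mod p).

Vector : ℕ → ℕ → Set
Vector p n = Fin n → Fin p

Matrix : ℕ → ℕ → ℕ → Set
Matrix p m n = Fin m → Fin n → Fin p

sumFin : ∀ {m} → (Fin m → ℕ) → ℕ
sumFin {zero}  f = 0
sumFin {suc m} f = f fzero + sumFin (λ i → f (fsuc i))

weight : ∀ {p n} → Vector p n → ℕ
weight {p} {n} v = sumFin (λ j → nz (toℕ (v j)))
  where
  nz : ℕ → ℕ
  nz k with k ≟ 0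
  ... | yes _ = 0
  ... | no  _ = 1

InRow : ∀ {p m n} → Prime p → Matrix p m n → Vector p n → Set
InRow {p} {m} {n} pp M v =
  ∃ λ (a : Fin m → Fin p) →
    ∀ (j : Fin n) → toℕ (v j) ≡ sumFin (λ i → toℕ (a i) * toℕ (M i j)) % p
  where instance _ = prime⇒nonZero pp

IsCapacity : ∀ {p m n} → Prime p → Matrix p m n → ℕ → Set
IsCapacity {p} {m} {n} pp M k =
  (∃ λ (v : Vector p n) → InRow pp M v × weight v ≡ k)
  × (∀ (v : Vector p n) → InRow pp M v → weight v ≤ k)

NoZeroColumn : ∀ {p m n} → Matrix p m n → Set
NoZeroColumn {p} {m} {n} M = ∀ (j : Fin n) → ∃ λ (i : Fin m) → toℕ (M i j) ≢ 0

InMstar : ∀ {p} (n m : ℕ) → Matrix p m n → Set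
InMstar {p} n m M = (1 ≤ m) × (m ≤ p ^ n) × NoZeroColumn M

IsLambda : ∀ {p} → Prime p → ℕ → ℕ → Set
IsLambda {p} pp n k =
  (Σ ℕ λ m → Σ (Matrix p m n) λ M → InMstar n m M × IsCapacity pp M k)
  × (∀ (m : ℕ) (M : Matrix p m n) → InMstar n m M →
       ∀ (c : ℕ) → IsCapacity pp M c → k ≤ c)

-- Build the coefficients of a row combination column by column, keeping its
-- first k coordinates nonzero mod p.  To make column k nonzero as well, pick a
-- row i with M i k ≠ 0 and add t times row i, for t < p.  A shift can only fail
-- at a column j ≤ k with M i j ≠ 0, and as p is prime each such column rules out
-- at most one t.  If row i vanishes at some column ≤ k there are at most k < p
-- such columns, so some shift succeeds; otherwise row i alone is nonzero on all
-- columns ≤ k.  This gives a row-space vector of weight n whenever n ≤ p, and a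
-- single all-ones row attains it.
module Submission where

open import Defs
open import Data.Nat using (ℕ; _≤_)
open import Data.Nat.Primality using (Prime)

open import Data.Nat using (zero; suc; _+_; _*_; _∸_; _<_; _%_; z≤n; s≤s; NonZero)
open import Data.Nat.Properties
open import Data.Nat.DivMod using (%-distribˡ-+; %-distribˡ-*; m%n%n≡m%n; m%n<n)
open import Data.Nat.Divisibility using (_∣_; _∣?_; ∣m+n∣m⇒∣n; m%n≡0⇒n∣m; >⇒∤)
open import Data.Nat.Primality using (euclidsLemma; prime⇒nonZero; prime⇒nonTrivial)
open import Data.Nat.Base using (nonTrivial⇒n>1)
open import Data.Nat.Solver using (module +-*-Solver)
open import Data.Fin as Fin using (Fin; toℕ; fromℕ<; punchOut) renaming (zero to fzero; suc to fsuc)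
open import Data.Fin.Properties
  using (toℕ-injective; toℕ<n; toℕ-fromℕ<; fromℕ<-injective; pigeonhole; punchOut-injective; any?; all?; ¬∀⟶∃¬)
open import Data.Product using (∃; ∃₂; _×_; _,_; proj₁; proj₂)
open import Data.Sum using (inj₁; inj₂)
open import Data.Empty using (⊥-elim)
open import Function using (_∘_)
open import Relation.Nullary using (¬_; Dec; yes; no; contradiction)
open import Relation.Nullary.Decidable using (_→-dec_; ¬?)
open import Relation.Unary using (Pred; Decidable)
open import Relation.Binary.PropositionalEquality
open +-*-Solver using (solve; _:+_; _:*_; _:=_)

sumFin-cong : ∀ {m} {f g : Fin m → ℕ} → (∀ i → f i ≡ g i) → sumFin f ≡ sumFin g
sumFin-cong {zero}  f≗g = refl
sumFin-cong {suc m} f≗g = cong₂ _+_ (f≗g fzero) (sumFin-cong (f≗g ∘ fsuc))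

sumFin-distrib-+ : ∀ {m} (f g : Fin m → ℕ) → sumFin (λ i → f i + g i) ≡ sumFin f + sumFin g
sumFin-distrib-+ {zero}  f g = refl
sumFin-distrib-+ {suc m} f g = begin
  (f fzero + g fzero) + sumFin (λ i → f (fsuc i) + g (fsuc i))
    ≡⟨ cong (f fzero + g fzero +_) (sumFin-distrib-+ (f ∘ fsuc) (g ∘ fsuc)) ⟩
  (f fzero + g fzero) + (sumFin (f ∘ fsuc) + sumFin (g ∘ fsuc))
    ≡⟨ solve 4 (λ a b c d → (a :+ b) :+ (c :+ d) := (a :+ c) :+ (b :+ d)) refl
         (f fzero) (g fzero) (sumFin (f ∘ fsuc)) (sumFin (g ∘ fsuc)) ⟩
  (f fzero + sumFin (f ∘ fsuc)) + (g fzero + sumFin (g ∘ fsuc)) ∎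
  where open ≡-Reasoning

*-distribˡ-sumFin : ∀ {m} t (f : Fin m → ℕ) → sumFin (λ i → t * f i) ≡ t * sumFin f
*-distribˡ-sumFin {zero}  t f = sym (*-zeroʳ t)
*-distribˡ-sumFin {suc m} t f =
  trans (cong (t * f fzero +_) (*-distribˡ-sumFin t (f ∘ fsuc))) (sym (*-distribˡ-+ t (f fzero) _))

sumFin-zero : ∀ m → sumFin {m} (λ _ → 0) ≡ 0
sumFin-zero zero    = refl
sumFin-zero (suc m) = sumFin-zero m

δ : ∀ {m} → Fin m → Fin m → ℕ
δ fzero    fzero    = 1
δ fzero    (fsuc _) = 0
δ (fsuc _) fzero    = 0
δ (fsuc i) (fsuc j) = δ i j

sumFin-δ : ∀ {m} (i : Fin m) (f : Fin m → ℕ) → sumFin (λ i′ → δ i i′ * f i′) ≡ f i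
sumFin-δ {suc m} fzero    f = trans (cong₂ _+_ (*-identityˡ (f fzero)) (sumFin-zero m)) (+-identityʳ (f fzero))
sumFin-δ {suc m} (fsuc i) f = sumFin-δ i (f ∘ fsuc)

sumFin-%-coefficients : ∀ {m} p .{{_ : NonZero p}} (a x : Fin m → ℕ) →
                        sumFin (λ i → (a i % p) * x i) % p ≡ sumFin (λ i → a i * x i) % p
sumFin-%-coefficients {zero}  p a x = refl
sumFin-%-coefficients {suc m} p a x = begin
  ((a fzero % p) * x fzero + sumFin (λ i → (a (fsuc i) % p) * x (fsuc i))) % p
    ≡⟨ %-distribˡ-+ _ _ p ⟩
  (((a fzero % p) * x fzero) % p + sumFin (λ i → (a (fsuc i) % p) * x (fsuc i)) % p) % p
    ≡⟨ cong₂ (λ u w → (u + w) % p) head tail ⟩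
  ((a fzero * x fzero) % p + sumFin (λ i → a (fsuc i) * x (fsuc i)) % p) % p
    ≡⟨ %-distribˡ-+ _ _ p ⟨
  (a fzero * x fzero + sumFin (λ i → a (fsuc i) * x (fsuc i))) % p ∎
  where
  open ≡-Reasoning
  head : ((a fzero % p) * x fzero) % p ≡ (a fzero * x fzero) % p
  head = trans (%-distribˡ-* _ _ p)
               (trans (cong (λ u → (u * (x fzero % p)) % p) (m%n%n≡m%n (a fzero) p))
                      (sym (%-distribˡ-* _ _ p)))
  tail = sumFin-%-coefficients p (a ∘ fsuc) (x ∘ fsuc)

weight≤length : ∀ {p n} (v : Vector p n) → weight v ≤ n
weight≤length {n = zero}  v = z≤n
weight≤length {n = suc n} v with toℕ (v fzero) ≟ 0
... | yes _ = m≤n⇒m≤1+n (weight≤length (v ∘ fsuc))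
... | no  _ = s≤s (weight≤length (v ∘ fsuc))

weight-nowhereZero : ∀ {p n} (v : Vector p n) → (∀ j → toℕ (v j) ≢ 0) → weight v ≡ n
weight-nowhereZero {n = zero}  v v≢0 = refl
weight-nowhereZero {n = suc n} v v≢0 with toℕ (v fzero) ≟ 0
... | yes v₀≡0 = contradiction v₀≡0 (v≢0 fzero)
... | no  _    = cong suc (weight-nowhereZero (v ∘ fsuc) (v≢0 ∘ fsuc))

∣∧<⇒≡0 : ∀ {p d} → p ∣ d → d < p → d ≡ 0
∣∧<⇒≡0 {d = zero}  _   _   = refl
∣∧<⇒≡0 {d = suc _} p∣d d<p = contradiction p∣d (>⇒∤ d<p)

affine-root-unique-≤ : ∀ {p} → Prime p → ∀ s {c t₁ t₂} → ¬ p ∣ c → t₁ ≤ t₂ → t₂ < p →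
                       p ∣ s + t₁ * c → p ∣ s + t₂ * c → t₁ ≡ t₂
affine-root-unique-≤ {p} pp s {c} {t₁} {t₂} p∤c t₁≤t₂ t₂<p p∣root₁ p∣root₂ = begin
  t₁          ≡⟨ +-identityʳ t₁ ⟨
  t₁ + 0      ≡⟨ cong (t₁ +_) d≡0 ⟨
  t₁ + d      ≡⟨ m+[n∸m]≡n t₁≤t₂ ⟩
  t₂          ∎
  where
  open ≡-Reasoning
  d = t₂ ∸ t₁
  split : s + t₂ * c ≡ (s + t₁ * c) + d * c
  split = trans (cong (λ u → s + u * c) (sym (m+[n∸m]≡n t₁≤t₂)))
                (solve 4 (λ s t d c → s :+ (t :+ d) :* c := (s :+ t :* c) :+ d :* c) refl s t₁ d c)
  d≡0 : d ≡ 0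
  d≡0 with euclidsLemma d c pp (∣m+n∣m⇒∣n (subst (p ∣_) split p∣root₂) p∣root₁)
  ... | inj₁ p∣d = ∣∧<⇒≡0 p∣d (≤-<-trans (m∸n≤m t₂ t₁) t₂<p)
  ... | inj₂ p∣c = contradiction p∣c p∤c

affine-root-unique : ∀ {p} → Prime p → ∀ s {c t₁ t₂} → ¬ p ∣ c → t₁ < p → t₂ < p →
                     p ∣ s + t₁ * c → p ∣ s + t₂ * c → t₁ ≡ t₂
affine-root-unique pp s {t₁ = t₁} {t₂} p∤c t₁<p t₂<p p∣root₁ p∣root₂ with ≤-total t₁ t₂
... | inj₁ t₁≤t₂ = affine-root-unique-≤ pp s p∤c t₁≤t₂ t₂<p p∣root₁ p∣root₂
... | inj₂ t₂≤t₁ = sym (affine-root-unique-≤ pp s p∤c t₂≤t₁ t₁<p p∣root₂ p∣root₁)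

pigeonhole-avoiding : ∀ {k p n} → k < p → (f : Fin p → Fin n) (z : Fin n) →
                      (∀ t → toℕ (f t) < suc k) → toℕ z < suc k → (∀ t → f t ≢ z) →
                      ∃₂ λ t₁ t₂ → t₁ Fin.< t₂ × f t₁ ≡ f t₂
pigeonhole-avoiding k<p f z f<1+k z<1+k f≢z =
  let t₁ , t₂ , t₁<t₂ , eq = pigeonhole k<p (λ t → punchOut (z≢f t))
  in t₁ , t₂ , t₁<t₂ , restrict-injective (punchOut-injective (z≢f t₁) (z≢f t₂) eq)
  where
  restrict-injective : ∀ {t₁ t₂} → fromℕ< (f<1+k t₁) ≡ fromℕ< (f<1+k t₂) → f t₁ ≡ f t₂
  restrict-injective eq = toℕ-injective (fromℕ<-injective _ _ (f<1+k _) (f<1+k _) eq)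
  z≢f : ∀ t → fromℕ< z<1+k ≢ fromℕ< (f<1+k t)
  z≢f t eq = f≢z t (toℕ-injective (sym (fromℕ<-injective _ _ z<1+k (f<1+k t) eq)))

¬∀[⇒¬]⟶∃[×] : ∀ {n ℓ₁ ℓ₂} {P : Pred (Fin n) ℓ₁} {Q : Pred (Fin n) ℓ₂} → Decidable P → Decidable Q →
              ¬ (∀ j → P j → ¬ Q j) → ∃ λ j → P j × Q j
¬∀[⇒¬]⟶∃[×] {n} P? Q? ¬∀ with ¬∀⟶∃¬ n _ (λ j → P? j →-dec ¬? (Q? j)) ¬∀
... | j , ¬[Pj⇒¬Qj] with P? j | Q? j
...   | yes Pj | yes Qj = j , Pj , Qj
...   | no ¬Pj | _      = contradiction (λ Pj → contradiction Pj ¬Pj) ¬[Pj⇒¬Qj]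
...   | _      | no ¬Qj = contradiction (λ _ → ¬Qj) ¬[Pj⇒¬Qj]

module RowCombination {p} (pp : Prime p) {m n} (M : Matrix p m n) where
  private instance
    p≢0 : NonZero p
    p≢0 = prime⇒nonZero pp

  combination : (Fin m → ℕ) → Fin n → ℕ
  combination a j = sumFin (λ i → a i * toℕ (M i j))

  shift : (Fin m → ℕ) → Fin m → ℕ → Fin m → ℕ
  shift a i t i′ = a i′ + t * δ i i′

  combination-δ : ∀ i j → combination (δ i) j ≡ toℕ (M i j)
  combination-δ i j = sumFin-δ i (λ i′ → toℕ (M i′ j))

  combination-shift : ∀ a i t j → combination (shift a i t) j ≡ combination a j + t * toℕ (M i j)
  combination-shift a i t j = begin
    sumFin (λ i′ → (a i′ + t * δ i i′) * M′ i′)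
      ≡⟨ sumFin-cong (λ i′ → solve 4 (λ a t e x → (a :+ t :* e) :* x := a :* x :+ t :* (e :* x)) refl
                                      (a i′) t (δ i i′) (M′ i′)) ⟩
    sumFin (λ i′ → a i′ * M′ i′ + t * (δ i i′ * M′ i′))
      ≡⟨ sumFin-distrib-+ (λ i′ → a i′ * M′ i′) (λ i′ → t * (δ i i′ * M′ i′)) ⟩
    combination a j + sumFin (λ i′ → t * (δ i i′ * M′ i′))
      ≡⟨ cong (combination a j +_) (*-distribˡ-sumFin t (λ i′ → δ i i′ * M′ i′)) ⟩
    combination a j + t * sumFin (λ i′ → δ i i′ * M′ i′)
      ≡⟨ cong (λ u → combination a j + t * u) (sumFin-δ i M′) ⟩
    combination a j + t * toℕ (M i j) ∎
    where
    open ≡-Reasoning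
    M′ : Fin m → ℕ
    M′ i′ = toℕ (M i′ j)

  NonZeroBelow : ℕ → (Fin m → ℕ) → Set
  NonZeroBelow k a = ∀ j → toℕ j < k → ¬ p ∣ combination a j

  nonZeroBelow? : ∀ k a → Dec (NonZeroBelow k a)
  nonZeroBelow? k a = all? (λ j → (toℕ j <? k) →-dec ¬? (p ∣? combination a j))

  zeroBelow : ∀ k a → ¬ NonZeroBelow k a → ∃ λ j → toℕ j < k × p ∣ combination a j
  zeroBelow k a = ¬∀[⇒¬]⟶∃[×] (λ j → toℕ j <? k) (λ j → p ∣? combination a j)

  module _ {k a} (a-good : NonZeroBelow k a) {i col} (col≡k : toℕ col ≡ k) (M-i-col≢0 : toℕ (M i col) ≢ 0) where

    shift-fails-only-where-row-nonzero : ∀ t {j} → toℕ j < suc k → p ∣ combination (shift a i t) j →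
                                         toℕ (M i j) ≢ 0
    shift-fails-only-where-row-nonzero t {j} j<1+k p∣shifted M-ij≡0 with m<1+n⇒m<n∨m≡n j<1+k
    ... | inj₁ j<k = a-good j j<k (subst (p ∣_) unchanged p∣shifted)
      where
      unchanged : combination (shift a i t) j ≡ combination a j
      unchanged = begin
        combination (shift a i t) j        ≡⟨ combination-shift a i t j ⟩
        combination a j + t * toℕ (M i j)  ≡⟨ cong (λ c → combination a j + t * c) M-ij≡0 ⟩
        combination a j + t * 0            ≡⟨ cong (combination a j +_) (*-zeroʳ t) ⟩
        combination a j + 0                ≡⟨ +-identityʳ _ ⟩
        combination a j                    ∎
        where open ≡-Reasoning
    ... | inj₂ j≡k = M-i-col≢0 (subst (λ c → toℕ (M i c) ≡ 0) (toℕ-injective (trans j≡k (sym col≡k))) M-ij≡0)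

    some-shift-nonZeroBelow : k < p → ∀ {j₀} → toℕ j₀ < suc k → toℕ (M i j₀) ≡ 0 →
                              ∃ λ t → NonZeroBelow (suc k) (shift a i t)
    some-shift-nonZeroBelow k<p {j₀} j₀<1+k M-ij₀≡0
      with any? (λ (t : Fin p) → nonZeroBelow? (suc k) (shift a i (toℕ t)))
    ... | yes (t , t-good) = toℕ t , t-good
    ... | no no-shift-good =
      let t₁ , t₂ , t₁<t₂ , same-column = pigeonhole-avoiding k<p failing j₀
                                            (proj₁ ∘ proj₂ ∘ failure) j₀<1+k failing≢j₀
      in ⊥-elim (<-irrefl (same-root same-column) t₁<t₂)
      where
      failure : ∀ t → ∃ λ j → toℕ j < suc k × p ∣ combination (shift a i (toℕ t)) j
      failure t = zeroBelow (suc k) (shift a i (toℕ t)) (λ t-good → no-shift-good (t , t-good))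
      failing : Fin p → Fin n
      failing = proj₁ ∘ failure
      M-i-failing≢0 : ∀ t → toℕ (M i (failing t)) ≢ 0
      M-i-failing≢0 t = let _ , j<1+k , p∣shifted = failure t
                        in shift-fails-only-where-row-nonzero (toℕ t) j<1+k p∣shifted
      failing≢j₀ : ∀ t → failing t ≢ j₀
      failing≢j₀ t refl = M-i-failing≢0 t M-ij₀≡0
      root : ∀ t → p ∣ combination a (failing t) + toℕ t * toℕ (M i (failing t))
      root t = subst (p ∣_) (combination-shift a i (toℕ t) (failing t)) (proj₂ (proj₂ (failure t)))
      same-root : ∀ {t₁ t₂} → failing t₁ ≡ failing t₂ → toℕ t₁ ≡ toℕ t₂
      same-root {t₁} {t₂} eq = affine-root-unique pp _
        (λ p∣M → M-i-failing≢0 t₁ (∣∧<⇒≡0 p∣M (toℕ<n _))) (toℕ<n t₁) (toℕ<n t₂)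
        (root t₁) (subst (λ j → p ∣ combination a j + toℕ t₂ * toℕ (M i j)) (sym eq) (root t₂))

  module _ (no-zero-column : NoZeroColumn M) where

    extend : ∀ {k} → k < n → k < p → ∀ {a} → NonZeroBelow k a → ∃ (NonZeroBelow (suc k))
    extend {k} k<n k<p {a} a-good with no-zero-column (fromℕ< k<n)
    ... | i , M-i-col≢0 with nonZeroBelow? (suc k) (δ i)
    ...   | yes δ-good = δ i , δ-good
    ...   | no ¬δ-good =
      let j₀ , j₀<1+k , p∣M-ij₀ = zeroBelow (suc k) (δ i) ¬δ-good
          M-ij₀≡0 = ∣∧<⇒≡0 (subst (p ∣_) (combination-δ i j₀) p∣M-ij₀) (toℕ<n (M i j₀))
          t , shift-good = some-shift-nonZeroBelow {a = a} a-good (toℕ-fromℕ< k<n) M-i-col≢0 k<p j₀<1+k M-ij₀≡0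
      in shift a i t , shift-good

    nonZeroBelow-exists : ∀ k → k ≤ n → k ≤ p → ∃ (NonZeroBelow k)
    nonZeroBelow-exists zero    _     _     = (λ _ → 0) , λ _ ()
    nonZeroBelow-exists (suc k) k<n k<p =
      let a , a-good = nonZeroBelow-exists k (<⇒≤ k<n) (<⇒≤ k<p)
      in extend k<n k<p {a} a-good

    full-weight-row-vector : n ≤ p → ∃ λ (v : Vector p n) → InRow pp M v × weight v ≡ n
    full-weight-row-vector n≤p = v , (a mod p , v∈row) , weight-nowhereZero v v≢0
      where
      a : Fin m → ℕ
      a = proj₁ (nonZeroBelow-exists n ≤-refl n≤p)
      a-good : NonZeroBelow n a
      a-good = proj₂ (nonZeroBelow-exists n ≤-refl n≤p)
      _mod_ : ∀ {ℓ} → (Fin ℓ → ℕ) → (q : ℕ) .{{_ : NonZero q}} → Fin ℓ → Fin q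
      (x mod q) i = fromℕ< (m%n<n (x i) q)
      v : Vector p n
      v = combination a mod p
      v∈row : ∀ j → toℕ (v j) ≡ sumFin (λ i → toℕ ((a mod p) i) * toℕ (M i j)) % p
      v∈row j = begin
        toℕ (v j)                                              ≡⟨ toℕ-fromℕ< _ ⟩
        combination a j % p                                    ≡⟨ sumFin-%-coefficients p a (λ i → toℕ (M i j)) ⟨
        sumFin (λ i → (a i % p) * toℕ (M i j)) % p             ≡⟨ cong (_% p) (sumFin-cong λ i →
                                                                    cong (_* toℕ (M i j)) (toℕ-fromℕ< (m%n<n (a i) p))) ⟨
        sumFin (λ i → toℕ ((a mod p) i) * toℕ (M i j)) % p     ∎
        where open ≡-Reasoning
      v≢0 : ∀ j → toℕ (v j) ≢ 0
      v≢0 j vj≡0 = a-good j (toℕ<n j) (m%n≡0⇒n∣m _ p (trans (sym (toℕ-fromℕ< _)) vj≡0))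

    isCapacity-length : n ≤ p → IsCapacity pp M n
    isCapacity-length n≤p = full-weight-row-vector n≤p , λ v _ → weight≤length v

    length≤capacity : n ≤ p → ∀ {c} → IsCapacity pp M c → n ≤ c
    length≤capacity n≤p (_ , weight≤c) =
      let v , v∈row , weight≡n = full-weight-row-vector n≤p
      in subst (_≤ _) weight≡n (weight≤c v v∈row)

open RowCombination using (isCapacity-length; length≤capacity)

corollary2p2 : (p n : ℕ) (pp : Prime p) → 1 ≤ n → n ≤ p → IsLambda pp n n
corollary2p2 p n pp _ n≤p =
  (1 , ones , (≤-refl , m^n>0 p n , ones-no-zero-column) ,
   isCapacity-length pp ones ones-no-zero-column n≤p) ,
  λ m M (_ , _ , no-zero-column) _ → length≤capacity pp M no-zero-column n≤p
  where
  instance _ = prime⇒nonZero pp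
  1<p : 1 < p
  1<p = nonTrivial⇒n>1 p {{prime⇒nonTrivial pp}}
  ones : Matrix p 1 n
  ones _ _ = fromℕ< 1<p
  ones-no-zero-column : NoZeroColumn ones
  ones-no-zero-column _ = fzero , λ one≡0 → 1+n≢0 (trans (sym (toℕ-fromℕ< 1<p)) one≡0)
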